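{- If $v=v_1\cdots v_{2n}$ and $w=w_1\cdots w_{2n}$ are two equivalent operation sequences, both of which output eagerly, then they have the same type.
   Context: Two parallel stacks: input items $1,\dots,n$ arrive in order. An operation sequence is a word over $\{I_1,I_2,O_1,O_2\}$ ($I_i$ pushes the next input item onto stack $i$, $O_i$ pops stack $i$ to the output) with as many $I_i$ as $O_i$ for $i=1,2$ and every prefix having at least as many $I_i$ as $O_i$; it produces the permutation given by the output order. Two operation sequences are equivalent if they produce the same permutation. A sequence outputs eagerly if it contains neither $I_1O_2$ nor $I_2O_1$ as a factor. The type of a sequence is the word over $\{I,O\}$ obtained by deleting subscripts. -}

module Defs where

open import Data.Nat using (ℕ; zero; suc; _≤_)
open import Data.List using (List; []; _∷_; _++_; map; length)
open import Data.Empty using (⊥)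
open import Data.Maybe using (Maybe; just; nothing)
open import Data.Product using (_×_; _,_)
open import Relation.Binary.PropositionalEquality using (_≡_)

data Stack : Set where
  s₁ s₂ : Stack

-- Operations: I s pushes the next input onto stack s, O s pops stack s to output.
data Op : Set where
  I O : Stack → Op

data IO : Set where
  I' O' : IO

type : List Op → List IO
type = map f
  where
  f : Op → IO
  f (I _) = I'
  f (O _) = O'

countI : Stack → List Op → ℕ
countI s [] = 0
countI s₁ (I s₁ ∷ w) = suc (countI s₁ w)
countI s₂ (I s₂ ∷ w) = suc (countI s₂ w)
countI s (_ ∷ w) = countI s w

countO : Stack → List Op → ℕ
countO s [] = 0
countO s₁ (O s₁ ∷ w) = suc (countO s₁ w)
countO s₂ (O s₂ ∷ w) = suc (countO s₂ w)
countO s (_ ∷ w) = countO s w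

record OpSeq (w : List Op) : Set where
  field
    balanced : ∀ s → countI s w ≡ countO s w
    prefixes : ∀ s p q → w ≡ p ++ q → countO s p ≤ countI s p

-- Simulation: input items 1, 2, ... ; state = next input item, the two stacks,
-- output so far (reversed). Popping an empty stack fails (nothing); this never
-- happens for operation sequences.
private
  pop : List ℕ → Maybe (ℕ × List ℕ)
  pop [] = nothing
  pop (x ∷ xs) = just (x , xs)

run : ℕ → List ℕ → List ℕ → List Op → Maybe (List ℕ)
run next st₁ st₂ [] = just []
run next st₁ st₂ (I s₁ ∷ w) = run (suc next) (next ∷ st₁) st₂ w
run next st₁ st₂ (I s₂ ∷ w) = run (suc next) st₁ (next ∷ st₂) w
run next [] st₂ (O s₁ ∷ w) = nothing
run next (x ∷ st₁) st₂ (O s₁ ∷ w) with run next st₁ st₂ w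
... | nothing = nothing
... | just out = just (x ∷ out)
run next st₁ [] (O s₂ ∷ w) = nothing
run next st₁ (x ∷ st₂) (O s₂ ∷ w) with run next st₁ st₂ w
... | nothing = nothing
... | just out = just (x ∷ out)

-- the permutation produced by an operation sequence, in one-line notation
-- (the list of input items 1..n in output order)
output : List Op → Maybe (List ℕ)
output = run 1 [] []

Equivalent : List Op → List Op → Set
Equivalent v w = output v ≡ output w

OutputsEagerly : List Op → Set
OutputsEagerly w = (p q : List Op) →
  (w ≡ p ++ (I s₁ ∷ O s₂ ∷ q) → ⊥) × (w ≡ p ++ (I s₂ ∷ O s₁ ∷ q) → ⊥)

-- Run both sequences in lockstep on the common output. While both push, they push the
-- same input item; while both pop, they output the same item, so only the type letter
-- matters. If one pops while the other pushes, the popped item already lies on a stack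
-- and is smaller than the next input item, whereas an eager sequence that pushes next
-- outputs an item that has not been read yet. Hence the types agree letter by letter.

module Submission where

open import Defs
open import Data.Nat using (ℕ; _+_; _*_; suc; _<_; _≤_)
open import Data.Nat.Properties
  using (+-suc; +-identityʳ; ≤-pred; ≤-trans; ≤-reflexive; n<1+n; m<n⇒m<1+n; <⇒≱; n≤1+n; suc-injective)
open import Data.List using (List; length; []; _∷_; _++_)
open import Data.List.Properties using (∷-injectiveˡ; ∷-injectiveʳ)
open import Data.List.Relation.Unary.All as All using (All; []; _∷_)
open import Data.Product using (∃-syntax; _×_; _,_; proj₁; proj₂)
open import Data.Maybe using (just)
open import Data.Empty using (⊥; ⊥-elim)
open import Function using (id)
open import Relation.Binary.PropositionalEquality using (_≡_; refl; cong; sym; trans)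

data Pushed (x : ℕ) : Stack → List ℕ → List ℕ → List ℕ → List ℕ → Set where
  push₁ : ∀ {a b} → Pushed x s₁ a b (x ∷ a) b
  push₂ : ∀ {a b} → Pushed x s₂ a b a (x ∷ b)

data Popped (x : ℕ) : Stack → List ℕ → List ℕ → List ℕ → List ℕ → Set where
  pop₁ : ∀ {a b} → Popped x s₁ (x ∷ a) b a b
  pop₂ : ∀ {a b} → Popped x s₂ a (x ∷ b) a b

record PushStep (s : Stack) (n : ℕ) (st₁ st₂ : List ℕ) (v : List Op) : Set where
  constructor pushStep
  field
    {t₁ t₂} : List ℕ
    pushed : Pushed n s st₁ st₂ t₁ t₂
    rest : run n st₁ st₂ (I s ∷ v) ≡ run (suc n) t₁ t₂ v

record PopStep (s : Stack) (n : ℕ) (st₁ st₂ : List ℕ) (v : List Op) (out : List ℕ) : Set where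
  constructor popStep
  field
    {x} : ℕ
    {t₁ t₂ out′} : List ℕ
    popped : Popped x s st₁ st₂ t₁ t₂
    rest : run n t₁ t₂ v ≡ just out′
    output≡ : out ≡ x ∷ out′

push-step : ∀ s n st₁ st₂ v → PushStep s n st₁ st₂ v
push-step s₁ n st₁ st₂ v = pushStep push₁ refl
push-step s₂ n st₁ st₂ v = pushStep push₂ refl

pop-step : ∀ s n st₁ st₂ v {out} → run n st₁ st₂ (O s ∷ v) ≡ just out → PopStep s n st₁ st₂ v out
pop-step s₁ n [] st₂ v ()
pop-step s₁ n (x ∷ st₁) st₂ v eq with run n st₁ st₂ v in r | eq
... | just o | refl = popStep pop₁ r refl
pop-step s₂ n [] [] v ()
pop-step s₂ n (_ ∷ _) [] v ()
pop-step s₂ n [] (x ∷ st₂) v eq with run n [] st₂ v in r | eq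
... | just o | refl = popStep pop₂ r refl
pop-step s₂ n (y ∷ st₁) (x ∷ st₂) v eq with run n (y ∷ st₁) st₂ v in r | eq
... | just o | refl = popStep pop₂ r refl

StacksBelow : ℕ → List ℕ → List ℕ → Set
StacksBelow n st₁ st₂ = All (_< n) st₁ × All (_< n) st₂

stacksBelow-pushed : ∀ {n s a b c d} → StacksBelow n a b → Pushed n s a b c d → StacksBelow (suc n) c d
stacksBelow-pushed {n} (a , b) push₁ = n<1+n n ∷ All.map m<n⇒m<1+n a , All.map m<n⇒m<1+n b
stacksBelow-pushed {n} (a , b) push₂ = All.map m<n⇒m<1+n a , n<1+n n ∷ All.map m<n⇒m<1+n b

stacksBelow-popped : ∀ {n x s a b c d} → StacksBelow n a b → Popped x s a b c d → x < n × StacksBelow n c d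
stacksBelow-popped (x<n ∷ a , b) pop₁ = x<n , (a , b)
stacksBelow-popped (a , x<n ∷ b) pop₂ = x<n , (a , b)

outputsEagerly-tail : ∀ {o w} → OutputsEagerly (o ∷ w) → OutputsEagerly w
outputsEagerly-tail {o} e p q = (λ eq → proj₁ (e (o ∷ p) q) (cong (o ∷_) eq))
                              , (λ eq → proj₂ (e (o ∷ p) q) (cong (o ∷_) eq))

-- After a push, an eager sequence keeps pushing until it pops the item it pushed last.
pushed-output-fresh : ∀ {n s a b t₁ t₂ w x out} → Pushed n s a b t₁ t₂ → OutputsEagerly (I s ∷ w) →
  run (suc n) t₁ t₂ w ≡ just (x ∷ out) → n ≤ x
pushed-output-fresh {w = []} _ _ ()
pushed-output-fresh {n} {t₁ = t₁} {t₂} {w = I s ∷ w} _ e r with push-step s (suc n) t₁ t₂ w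
... | pushStep pushed rest =
  ≤-trans (n≤1+n n) (pushed-output-fresh pushed (outputsEagerly-tail e) (trans (sym rest) r))
pushed-output-fresh {w = O s₂ ∷ w} push₁ e _ = ⊥-elim (proj₁ (e [] w) refl)
pushed-output-fresh {w = O s₁ ∷ w} push₂ e _ = ⊥-elim (proj₂ (e [] w) refl)
pushed-output-fresh {n} {t₁ = t₁} {t₂} {w = O s₁ ∷ w} push₁ _ r with pop-step s₁ (suc n) t₁ t₂ w r
... | popStep pop₁ _ out≡ = ≤-reflexive (sym (∷-injectiveˡ out≡))
pushed-output-fresh {n} {t₁ = t₁} {t₂} {w = O s₂ ∷ w} push₂ _ r with pop-step s₂ (suc n) t₁ t₂ w r
... | popStep pop₂ _ out≡ = ≤-reflexive (sym (∷-injectiveˡ out≡))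

push-pop-clash : ∀ {n st₁ st₂ u₁ u₂ s t v w out} → StacksBelow n u₁ u₂ → OutputsEagerly (I s ∷ v) →
  run n st₁ st₂ (I s ∷ v) ≡ just out → run n u₁ u₂ (O t ∷ w) ≡ just out → ⊥
push-pop-clash {n} {st₁} {st₂} {u₁} {u₂} {s} {t} {v} {w} below e r₁ r₂
  with push-step s n st₁ st₂ v | pop-step t n u₁ u₂ w r₂
... | pushStep pushed rest | popStep popped _ refl =
  <⇒≱ (proj₁ (stacksBelow-popped below popped)) (pushed-output-fresh pushed e (trans (sym rest) r₁))

same-output⇒same-type : ∀ {n st₁ st₂ u₁ u₂ v w out} → StacksBelow n st₁ st₂ → StacksBelow n u₁ u₂ →
  OutputsEagerly v → OutputsEagerly w → length v ≡ length w →
  run n st₁ st₂ v ≡ just out → run n u₁ u₂ w ≡ just out → type v ≡ type w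
same-output⇒same-type {v = []} {[]} _ _ _ _ _ _ _ = refl
same-output⇒same-type {n} {st₁} {st₂} {u₁} {u₂} {I s ∷ v} {I t ∷ w} b₁ b₂ e₁ e₂ len r₁ r₂
  with push-step s n st₁ st₂ v | push-step t n u₁ u₂ w
... | pushStep pushed₁ rest₁ | pushStep pushed₂ rest₂ =
  cong (I' ∷_) (same-output⇒same-type (stacksBelow-pushed b₁ pushed₁) (stacksBelow-pushed b₂ pushed₂)
    (outputsEagerly-tail e₁) (outputsEagerly-tail e₂) (suc-injective len)
    (trans (sym rest₁) r₁) (trans (sym rest₂) r₂))
same-output⇒same-type {n} {st₁} {st₂} {u₁} {u₂} {O s ∷ v} {O t ∷ w} b₁ b₂ e₁ e₂ len r₁ r₂
  with pop-step s n st₁ st₂ v r₁ | pop-step t n u₁ u₂ w r₂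
... | popStep popped₁ rest₁ out≡₁ | popStep popped₂ rest₂ out≡₂ =
  cong (O' ∷_) (same-output⇒same-type (proj₂ (stacksBelow-popped b₁ popped₁)) (proj₂ (stacksBelow-popped b₂ popped₂))
    (outputsEagerly-tail e₁) (outputsEagerly-tail e₂) (suc-injective len)
    rest₁ (trans rest₂ (cong just (∷-injectiveʳ (trans (sym out≡₂) out≡₁)))))
same-output⇒same-type {v = I _ ∷ _} {O _ ∷ _} _ b₂ e₁ _ _ r₁ r₂ = ⊥-elim (push-pop-clash b₂ e₁ r₁ r₂)
same-output⇒same-type {v = O _ ∷ _} {I _ ∷ _} b₁ _ _ e₂ _ r₁ r₂ = ⊥-elim (push-pop-clash b₁ e₂ r₂ r₁)

-- Starting with h items on stack s, running w never pops s while it is empty.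
Bounded : Stack → ℕ → List Op → Set
Bounded s h w = ∀ p q → w ≡ p ++ q → countO s p ≤ countI s p + h

bounded-∷ : ∀ {s h h′ o w} → (∀ p → countO s (o ∷ p) ≤ countI s (o ∷ p) + h → countO s p ≤ countI s p + h′) →
  Bounded s h (o ∷ w) → Bounded s h′ w
bounded-∷ {o = o} step bound p q refl = step p (bound (o ∷ p) q refl)

pushed-bound : ∀ {i o h} → o ≤ suc (i + h) → o ≤ i + suc h
pushed-bound {i} {h = h} le rewrite +-suc i h = le

popped-bound : ∀ {i o h} → suc o ≤ i + suc h → o ≤ i + h
popped-bound {i} {h = h} le rewrite +-suc i h = ≤-pred le

run-defined : ∀ n st₁ st₂ w → Bounded s₁ (length st₁) w → Bounded s₂ (length st₂) w →
  ∃[ out ] run n st₁ st₂ w ≡ just out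
run-defined n st₁ st₂ [] _ _ = [] , refl
run-defined n st₁ st₂ (I s₁ ∷ w) b₁ b₂ =
  run-defined (suc n) (n ∷ st₁) st₂ w (bounded-∷ (λ _ → pushed-bound) b₁) (bounded-∷ (λ _ → id) b₂)
run-defined n st₁ st₂ (I s₂ ∷ w) b₁ b₂ =
  run-defined (suc n) st₁ (n ∷ st₂) w (bounded-∷ (λ _ → id) b₁) (bounded-∷ (λ _ → pushed-bound) b₂)
run-defined n [] st₂ (O s₁ ∷ w) b₁ _ with b₁ (O s₁ ∷ []) w refl
... | ()
run-defined n (x ∷ st₁) st₂ (O s₁ ∷ w) b₁ b₂
  with run n st₁ st₂ w | run-defined n st₁ st₂ w (bounded-∷ (λ _ → popped-bound) b₁) (bounded-∷ (λ _ → id) b₂)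
... | just out | _ = x ∷ out , refl
run-defined n st₁ [] (O s₂ ∷ w) _ b₂ with b₂ (O s₂ ∷ []) w refl
... | ()
run-defined n [] (x ∷ st₂) (O s₂ ∷ w) b₁ b₂
  with run n [] st₂ w | run-defined n [] st₂ w (bounded-∷ (λ _ → id) b₁) (bounded-∷ (λ _ → popped-bound) b₂)
... | just out | _ = x ∷ out , refl
run-defined n (y ∷ st₁) (x ∷ st₂) (O s₂ ∷ w) b₁ b₂
  with run n (y ∷ st₁) st₂ w | run-defined n (y ∷ st₁) st₂ w (bounded-∷ (λ _ → id) b₁) (bounded-∷ (λ _ → popped-bound) b₂)
... | just out | _ = x ∷ out , refl

opSeq-output-defined : ∀ {w} → OpSeq w → ∃[ out ] output w ≡ just out
opSeq-output-defined {w} seq = run-defined 1 [] [] w (bounded₀ s₁) (bounded₀ s₂)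
  where
  bounded₀ : ∀ s → Bounded s 0 w
  bounded₀ s p q eq rewrite +-identityʳ (countI s p) = OpSeq.prefixes seq s p q eq

lemma2p3 : (n : ℕ) (v w : List Op) → length v ≡ 2 * n → length w ≡ 2 * n →
    OpSeq v → OpSeq w → Equivalent v w →
    OutputsEagerly v → OutputsEagerly w → type v ≡ type w
-- Definedness of one output transfers to the other through the equivalence.
lemma2p3 n v w lv lw _ seq-w v≈w eager-v eager-w with opSeq-output-defined seq-w
... | out , r = same-output⇒same-type ([] , []) ([] , []) eager-v eager-w (trans lv (sym lw)) (trans v≈w r) r
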